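{- Let $X$ be a finite simplicial complex on vertex set $V$ with $h(X)=d$. Let $k\geq 0$, $\sigma\in X(k)$, and $v\in V\setminus\sigma$. If $v\notin\mathrm{lk}(X,\sigma)$, then $$|N_\sigma(v)|=|M_\sigma(v)|\leq d.$$ Furthermore, if equality holds, then $$X[\{v\}\cup M_\sigma(v)]\cong\Delta_d^{(d-1)}\quad\text{and}\quad X[\{v\}\cup\sigma]\cong\Delta_d^{(d-1)}*\Delta_{k-d}.$$
   Context: An (abstract) simplicial complex $X$ on vertex set $V$ is a family of subsets of $V$ closed under taking subsets, with $V$ the union of its $0$-dimensional simplices; a simplex $\sigma$ has dimension $|\sigma|-1$, and $X(k)$ is the set of $k$-dimensional simplices. For a simplex $\sigma$, $\sigma(k-1)$ denotes the set of its $(k-1)$-dimensional faces (subsets of size $k$). A missing face of $X$ is a set $\sigma\subseteq V$ with $\sigma\notin X$ but every proper subset of $\sigma$ in $X$; $h(X)$ is the maximal dimension of a missing face. The link is $\mathrm{lk}(X,\sigma)=\{\tau\in X:\tau\cup\sigma\in X,\ \tau\cap\sigma=\varnothing\}$ (for a vertex $v$, "$v\in\mathrm{lk}(X,\sigma)$" means $\{v\}\in\mathrm{lk}(X,\sigma)$). For $U\subseteq V$, $X[U]=\{\sigma\in X:\sigma\subseteq U\}$. For $\sigma\in X(k)$ and $v\in V\setminus\sigma$, $N_\sigma(v)=\{\tau\in\sigma(k-1): v\in\mathrm{lk}(X,\tau)\}$ and $M_\sigma(v)=\{\sigma\setminus\tau:\tau\in N_\sigma(v)\}$ (a set of vertices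 of $\sigma$). $\Delta_m$ is the complete simplicial complex (all subsets) on $m+1$ vertices, with $\Delta_{ -1}=\{\varnothing\}$; $\Delta_m^{(j)}$ is its subcomplex of all subsets of size at most $j+1$. The join of complexes on disjoint vertex sets is $X*Y=\{\sigma\cup\tau:\sigma\in X,\tau\in Y\}$. $X\cong Y$ means there is a bijection of vertex sets which together with its inverse maps simplices to simplices. -}

module Defs where

open import Data.Nat using (ℕ; zero; suc; _+_; _≤_; _∸_)
open import Data.Nat.Properties using (_≟_)
open import Data.Bool using (Bool; true; false)
open import Data.Fin using (Fin)
open import Data.Fin.Subset using (Subset; _∈_; _∉_; _⊆_; _⊂_; _∪_; _-_; ⁅_⁆; ∣_∣; inside; outside)
open import Data.Fin.Subset.Properties using (_⊆?_; _∈?_)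
open import Data.Vec using (Vec; []; _∷_; tabulate; lookup; take; drop)
open import Data.List using (List; []; _∷_; map; _++_; filter; length)
open import Data.Product using (Σ; ∃; _×_; _,_)
open import Data.Empty using (⊥)
open import Relation.Nullary using (¬_; Dec; yes; no)
open import Relation.Nullary.Decidable using (_×-dec_; ¬?)
open import Relation.Unary using (Decidable)
open import Relation.Binary.PropositionalEquality using (_≡_)
open import Function.Bundles using (_⇔_)
open import Function.Definitions using (Injective)

record Complex (n : ℕ) : Set₁ where
  field
    face  : Subset n → Set
    face? : Decidable face
    down  : ∀ {s t} → s ⊆ t → face t → face s
    vert  : ∀ i → face ⁅ i ⁆
open Complex public

_∈X[_]_ : ∀ {n} → Subset n → Complex n → ℕ → Set
σ ∈X[ X ] k = face X σ × ∣ σ ∣ ≡ suc k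

Missing : ∀ {n} → Complex n → Subset n → Set
Missing X s = ¬ face X s × (∀ t → t ⊂ s → face X t)

-- h(X) = d : d is the maximal dimension of a missing face
-- (a missing face of dimension d exists, and all have dimension ≤ d)
HasH : ∀ {n} → Complex n → ℕ → Set
HasH X d = (∃ λ s → Missing X s × ∣ s ∣ ≡ suc d)
         × (∀ s → Missing X s → ∣ s ∣ ≤ suc d)

InLink : ∀ {n} → Complex n → Subset n → Fin n → Set
InLink X τ v = face X (τ ∪ ⁅ v ⁆) × v ∉ τ

inLink? : ∀ {n} (X : Complex n) τ v → Dec (InLink X τ v)
inLink? X τ v = face? X (τ ∪ ⁅ v ⁆) ×-dec ¬? (v ∈? τ)

allSubsets : ∀ n → List (Subset n)
allSubsets zero = [] ∷ []
allSubsets (suc n) = map (inside ∷_) (allSubsets n) ++ map (outside ∷_) (allSubsets n)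

-- N_σ(v) for σ ∈ X(k): (k-1)-faces τ of σ (τ ⊆ σ, |τ| = k) with v ∈ lk(X,τ)
N : ∀ {n} → Complex n → ℕ → Subset n → Fin n → List (Subset n)
N {n} X k σ v = filter (λ τ → (τ ⊆? σ) ×-dec ((∣ τ ∣ ≟ k) ×-dec inLink? X τ v)) (allSubsets n)

cardN : ∀ {n} → Complex n → ℕ → Subset n → Fin n → ℕ
cardN X k σ v = length (N X k σ v)

-- M_σ(v) = { σ \ τ : τ ∈ N_σ(v) }, as a set of vertices of σ:
-- u ∈ M iff u ∈ σ and the facet τ = σ - u of σ lies in N_σ(v)
M : ∀ {n} → Complex n → Subset n → Fin n → Subset n
M X σ v = tabulate λ u → Relation.Nullary.Decidable.⌊ (u ∈? σ) ×-dec inLink? X (σ - u) v ⌋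

-- X[U] ≅ Y, where Y is a complex on vertex set Fin m given by its face predicate:
-- a bijection f : Fin m → U such that T ∈ X[U] iff f⁻¹(T) ∈ Y for all T ⊆ U.
preimage : ∀ {m n} → (Fin m → Fin n) → Subset n → Subset m
preimage f T = tabulate λ j → lookup T (f j)

InducedIso : ∀ {n m} → Complex n → Subset n → (Subset m → Set) → Set
InducedIso {n} {m} X U Y =
  Σ (Fin m → Fin n) λ f →
    Injective _≡_ _≡_ f
    × (∀ j → f j ∈ U)
    × (∀ i → i ∈ U → ∃ λ j → f j ≡ i)
    × (∀ T → T ⊆ U → (face X T ⇔ Y (preimage f T)))

-- Δ_m as a complex on m+1 vertices: all subsets. We index by number of
-- vertices a, so Full (suc m) = Δ_m and Full 0 = Δ_{-1} = {∅}.
Full : ∀ a → Subset a → Set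
Full a S = Data.Unit.⊤ where import Data.Unit

BdSimplex : ∀ d → Subset (suc d) → Set
BdSimplex d S = ∣ S ∣ ≤ d

Join : ∀ {a b} → (Subset a → Set) → (Subset b → Set) → Subset (a + b) → Set
Join {a} P Q S = P (take a S) × Q (drop a S)

-- Write M for M_σ(v), U = {v} ∪ σ and S = {v} ∪ M. A subset of U that misses v
-- lies in σ, and one that misses some u ∈ M lies in (σ - u) ∪ {v}, which is a face
-- because u ∈ M; so every subset of U missing a vertex of S is a face. U itself is
-- not a face, since v ∉ lk(X, σ); a minimal non-face T ⊆ U is a missing face, and it
-- must contain S. Hence |M| + 1 = |S| ≤ |T| ≤ d + 1. If |M| = d then T = S, so the
-- faces of X[U] are exactly the subsets of U not containing S: X[S] is the boundary
-- of the simplex on S and X[U] is its join with the full simplex on σ - M.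
-- The equality |N| = |M| is the bijection τ ↦ σ - τ between the two.

module Submission where

open import Defs
open import Data.Bool using (true; false)
open import Data.Bool.Properties using (T-≡)
open import Data.Empty using (⊥-elim)
open import Data.Fin using (Fin; zero; suc; splitAt; join; _↑ˡ_; _↑ʳ_)
import Data.Fin.Properties as Fin
open import Data.Fin.Subset
open import Data.Fin.Subset.Properties
open import Data.List using ([]; _∷_; map; _++_; filter; length)
open import Data.List.Properties using (length-++; filter-++; filter-none; filter-≐)
import Data.List.Relation.Unary.All as All
open import Data.Nat using (ℕ; zero; suc; _+_; _≤_; _<_; _∸_; s≤s⁻¹)
open import Data.Nat.Induction using (<-wellFounded)
open import Data.Nat.Properties
  using (_≟_; +-comm; +-suc; m+n∸m≡n; suc-injective; ≤-reflexive; ≤-trans; ≤-antisym; <-irrefl; ≤∧≢⇒<; n≤0⇒n≡0)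
open import Data.Product using (∃; _×_; _,_; proj₁; proj₂)
open import Data.Sum using (_⊎_; inj₁; inj₂; [_,_]′)
import Data.Sum as Sum
open import Data.Unit using (tt)
open import Data.Vec using ([]; _∷_; here; there; tabulate; lookup; take)
open import Data.Vec.Properties
  using (∷-injectiveˡ; ∷-injectiveʳ; []=⇒lookup; lookup⇒[]=; lookup∘tabulate; tabulate-cong)
open import Function using (_∘_; case_of_)
open import Function.Bundles using (_⇔_; mk⇔; Equivalence)
open import Function.Definitions using (Injective)
open import Induction.WellFounded using (Acc; acc)
import Relation.Binary.Construct.On as On
open import Relation.Binary.PropositionalEquality
open import Relation.Nullary using (¬_; yes; no; does)
open import Relation.Nullary.Decidable using (_×-dec_; ¬?; ⌊_⌋; toWitness; isYes≗does; decidable-stable)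
open import Relation.Unary using (Decidable; _≐_)

open Equivalence using (to; from)

count : ∀ {n} {P : Subset n → Set} → Decidable P → ℕ
count {n} P? = length (filter P? (allSubsets n))

count-≐ : ∀ {n} {P Q : Subset n → Set} (P? : Decidable P) (Q? : Decidable Q) → P ≐ Q → count P? ≡ count Q?
count-≐ {n} P? Q? P≐Q = cong length (filter-≐ P? Q? P≐Q (allSubsets n))

count-none : ∀ {n} {P : Subset n → Set} (P? : Decidable P) → (∀ s → ¬ P s) → count P? ≡ 0
count-none {n} P? ¬P = cong length (filter-none P? (All.universal ¬P (allSubsets n)))

length-filter-map : ∀ {A B : Set} {P : B → Set} (P? : Decidable P) (f : A → B) xs →
  length (filter P? (map f xs)) ≡ length (filter (P? ∘ f) xs)
length-filter-map P? f []       = refl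
length-filter-map P? f (x ∷ xs) with does (P? (f x))
... | true  = cong suc (length-filter-map P? f xs)
... | false = length-filter-map P? f xs

count-∷ : ∀ {n} {P : Subset (suc n) → Set} (P? : Decidable P) →
  count P? ≡ count (P? ∘ (inside ∷_)) + count (P? ∘ (outside ∷_))
count-∷ {n} P? = begin
  length (filter P? (map (inside ∷_) subsets ++ map (outside ∷_) subsets))
    ≡⟨ cong length (filter-++ P? (map (inside ∷_) subsets) _) ⟩
  length (filter P? (map (inside ∷_) subsets) ++ filter P? (map (outside ∷_) subsets))
    ≡⟨ length-++ (filter P? (map (inside ∷_) subsets)) ⟩
  length (filter P? (map (inside ∷_) subsets)) + length (filter P? (map (outside ∷_) subsets))
    ≡⟨ cong₂ _+_ (length-filter-map P? (inside ∷_) subsets)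
                 (length-filter-map P? (outside ∷_) subsets) ⟩
  count (P? ∘ (inside ∷_)) + count (P? ∘ (outside ∷_)) ∎
  where
  open ≡-Reasoning
  subsets = allSubsets n

count-singleton : ∀ {n} {P : Subset n → Set} (P? : Decidable P) (t : Subset n) → P ≐ (_≡ t) → count P? ≡ 1
count-singleton P? [] P≐[] with P? []
... | yes _  = refl
... | no ¬p = ⊥-elim (¬p (proj₂ P≐[] refl))
count-singleton P? (inside ∷ t) P≐t = begin
  count P?
    ≡⟨ count-∷ P? ⟩
  count (P? ∘ (inside ∷_)) + count (P? ∘ (outside ∷_))
    ≡⟨ cong₂ _+_ (count-singleton (P? ∘ (inside ∷_)) t ((λ p → ∷-injectiveʳ (proj₁ P≐t p)) , λ { refl → proj₂ P≐t refl }))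
                 (count-none (P? ∘ (outside ∷_)) λ s p → case ∷-injectiveˡ (proj₁ P≐t p) of λ ()) ⟩
  1 ∎
  where open ≡-Reasoning
count-singleton P? (outside ∷ t) P≐t = begin
  count P?
    ≡⟨ count-∷ P? ⟩
  count (P? ∘ (inside ∷_)) + count (P? ∘ (outside ∷_))
    ≡⟨ cong₂ _+_ (count-none (P? ∘ (inside ∷_)) λ s p → case ∷-injectiveˡ (proj₁ P≐t p) of λ ())
                 (count-singleton (P? ∘ (outside ∷_)) t ((λ p → ∷-injectiveʳ (proj₁ P≐t p)) , λ { refl → proj₂ P≐t refl })) ⟩
  1 ∎
  where open ≡-Reasoning

∈p─q⇒∉q : ∀ {n} (p q : Subset n) {x} → x ∈ p ─ q → x ∉ q
∈p─q⇒∉q (_ ∷ p) (inside  ∷ q) () here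
∈p─q⇒∉q (_ ∷ p) (_ ∷ q) (there x∈p─q) (there x∈q) = ∈p─q⇒∉q p q x∈p─q x∈q

p⊆q⇒p∪[q─p]≡q : ∀ {n} {p q : Subset n} → p ⊆ q → p ∪ (q ─ p) ≡ q
p⊆q⇒p∪[q─p]≡q {p = p} {q} p⊆q = ⊆-antisym
  (λ x∈ → [ p⊆q , p─q⊆p q p ]′ (x∈p∪q⁻ p (q ─ p) x∈))
  (λ {x} x∈q → x∈p∪q⁺ (case x ∈? p of λ { (yes x∈p) → inj₁ x∈p ; (no x∉p) → inj₂ (x∈p∧x∉q⇒x∈p─q x∈q x∉p) }))

p⊆q⇒∣q∣≡∣p∣+∣q─p∣ : ∀ {n} {p q : Subset n} → p ⊆ q → ∣ q ∣ ≡ ∣ p ∣ + ∣ q ─ p ∣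
p⊆q⇒∣q∣≡∣p∣+∣q─p∣ {p = []}          {[]}          _   = refl
p⊆q⇒∣q∣≡∣p∣+∣q─p∣ {p = inside ∷ p}  {inside ∷ q}  p⊆q = cong suc (p⊆q⇒∣q∣≡∣p∣+∣q─p∣ (drop-∷-⊆ p⊆q))
p⊆q⇒∣q∣≡∣p∣+∣q─p∣ {p = inside ∷ p}  {outside ∷ q} p⊆q = case p⊆q here of λ ()
p⊆q⇒∣q∣≡∣p∣+∣q─p∣ {p = outside ∷ p} {inside ∷ q}  p⊆q =
  trans (cong suc (p⊆q⇒∣q∣≡∣p∣+∣q─p∣ (drop-∷-⊆ p⊆q))) (sym (+-suc ∣ p ∣ _))
p⊆q⇒∣q∣≡∣p∣+∣q─p∣ {p = outside ∷ p} {outside ∷ q} p⊆q = p⊆q⇒∣q∣≡∣p∣+∣q─p∣ (drop-∷-⊆ p⊆q)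

⊈⇒∃∉ : ∀ {n} {p q : Subset n} → p ⊈ q → ∃ λ x → x ∈ p × x ∉ q
⊈⇒∃∉ {p = p} {q} p⊈q with Fin.any? (λ x → (x ∈? p) ×-dec ¬? (x ∈? q))
... | yes x∈p─q = x∈p─q
... | no ¬∃     = ⊥-elim (p⊈q λ {x} x∈p → case x ∈? q of λ
                    { (yes x∈q) → x∈q ; (no x∉q) → ⊥-elim (¬∃ (x , x∈p , x∉q)) })

⊆-card-antisym : ∀ {n} {p q : Subset n} → p ⊆ q → ∣ q ∣ ≤ ∣ p ∣ → p ≡ q
⊆-card-antisym {p = p} {q} p⊆q ∣q∣≤∣p∣ = ⊆-antisym p⊆q q⊆p
  where
  q⊆p : q ⊆ p
  q⊆p {x} x∈q with x ∈? p
  ... | yes x∈p = x∈p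
  ... | no  x∉p = ⊥-elim (<-irrefl refl (≤-trans (p⊂q⇒∣p∣<∣q∣ (p⊆q , x , x∈q , x∉p)) ∣q∣≤∣p∣))

∣p∣≤n⇔⊤⊈p : ∀ {n} (p : Subset (suc n)) → ∣ p ∣ ≤ n ⇔ ⊤ ⊈ p
∣p∣≤n⇔⊤⊈p {n} p = mk⇔ ≤⇒⊈ ⊈⇒≤
  where
  ≤⇒⊈ : ∣ p ∣ ≤ n → ⊤ ⊈ p
  ≤⇒⊈ ∣p∣≤n ⊤⊆p = <-irrefl refl (≤-trans (subst (_≤ ∣ p ∣) (∣⊤∣≡n (suc n)) (p⊆q⇒∣p∣≤∣q∣ ⊤⊆p)) ∣p∣≤n)
  ⊈⇒≤ : ⊤ ⊈ p → ∣ p ∣ ≤ n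
  ⊈⇒≤ ⊤⊈p = s≤s⁻¹ (≤∧≢⇒< (∣p∣≤n p) λ ∣p∣≡1+n → ⊤⊈p (⊆-reflexive (sym (∣p∣≡n⇒p≡⊤ ∣p∣≡1+n))))

-- cardN X k σ v is count (facet? σ k Q?) and M X σ v is removable σ Q?,
-- for Q? τ = inLink? X τ v.
facet? : ∀ {n} {Q : Subset n → Set} (σ : Subset n) (k : ℕ) → Decidable Q →
  Decidable (λ τ → τ ⊆ σ × ∣ τ ∣ ≡ k × Q τ)
facet? σ k Q? τ = (τ ⊆? σ) ×-dec ((∣ τ ∣ ≟ k) ×-dec Q? τ)

removable : ∀ {n} {Q : Subset n → Set} → Subset n → Decidable Q → Subset n
removable σ Q? = tabulate λ u → ⌊ (u ∈? σ) ×-dec Q? (σ - u) ⌋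

∈-removable⁻ : ∀ {n} {Q : Subset n → Set} {σ u} (Q? : Decidable Q) → u ∈ removable σ Q? → u ∈ σ × Q (σ - u)
∈-removable⁻ {u = u} Q? u∈ = toWitness (from T-≡ (trans (sym (lookup∘tabulate _ u)) ([]=⇒lookup u∈)))

removable⊆ : ∀ {n} {Q : Subset n → Set} {σ} (Q? : Decidable Q) → removable σ Q? ⊆ σ
removable⊆ Q? u∈ = proj₁ (∈-removable⁻ Q? u∈)

-- ⌊_⌋ only computes once the decision is evaluated, so the tails agree only up to isYes≗does.
removable-∷ : ∀ {n} {Q : Subset (suc n) → Set} x (σ : Subset n) (Q? : Decidable Q) →
  removable (x ∷ σ) Q? ≡ ⌊ (zero ∈? x ∷ σ) ×-dec Q? ((x ∷ σ) - zero) ⌋ ∷ removable σ (Q? ∘ (x ∷_))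
removable-∷ x σ Q? = cong (⌊ (zero ∈? x ∷ σ) ×-dec Q? ((x ∷ σ) - zero) ⌋ ∷_) (tabulate-cong λ u → trans (isYes≗does _) (sym (isYes≗does _)))

-- Splitting on vertex zero: if it is outside σ no facet contains it; if it is inside σ,
-- the facets containing it correspond to those of the rest of σ, and exactly one facet,
-- σ - zero, avoids it.
count-facets : ∀ {n} {Q : Subset n → Set} (σ : Subset n) k (Q? : Decidable Q) →
  ∣ σ ∣ ≡ suc k → count (facet? σ k Q?) ≡ ∣ removable σ Q? ∣
count-facets [] k Q? ()
count-facets (outside ∷ σ) k Q? ∣σ∣≡1+k = begin
  count P?
    ≡⟨ count-∷ P? ⟩
  count (P? ∘ (inside ∷_)) + count (P? ∘ (outside ∷_))
    ≡⟨ cong₂ _+_ (count-none (P? ∘ (inside ∷_)) λ τ (τ⊆σ , _) → case τ⊆σ here of λ ())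
                 (count-≐ (P? ∘ (outside ∷_)) (facet? σ k Q?₀)
                   ((λ (τ⊆σ , rest) → drop-∷-⊆ τ⊆σ , rest) , λ (τ⊆σ , rest) → out⊆ τ⊆σ , rest)) ⟩
  count (facet? σ k Q?₀)
    ≡⟨ count-facets σ k Q?₀ ∣σ∣≡1+k ⟩
  ∣ removable σ Q?₀ ∣
    ≡⟨ cong ∣_∣ (removable-∷ outside σ Q?) ⟨
  ∣ removable (outside ∷ σ) Q? ∣ ∎
  where
  open ≡-Reasoning
  P?  = facet? (outside ∷ σ) k Q?
  Q?₀ = Q? ∘ (outside ∷_)
count-facets {Q = Q} (inside ∷ σ) k Q? ∣σ∣+1≡1+k = begin
  count P?
    ≡⟨ count-∷ P? ⟩
  count (P? ∘ (inside ∷_)) + count (P? ∘ (outside ∷_))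
    ≡⟨ cong (_+ count (P? ∘ (outside ∷_))) (count-∋zero k ∣σ∣≡k) ⟩
  ∣ removable σ Q?₁ ∣ + count (P? ∘ (outside ∷_))
    ≡⟨ +-comm ∣ removable σ Q?₁ ∣ _ ⟩
  count (P? ∘ (outside ∷_)) + ∣ removable σ Q?₁ ∣
    ≡⟨ count-∌zero (removable σ Q?₁) ⟩
  ∣ ⌊ (zero ∈? inside ∷ σ) ×-dec Q? (outside ∷ (σ ─ ⊥)) ⌋ ∷ removable σ Q?₁ ∣
    ≡⟨ cong ∣_∣ (removable-∷ inside σ Q?) ⟨
  ∣ removable (inside ∷ σ) Q? ∣ ∎
  where
  open ≡-Reasoning
  P?  = facet? (inside ∷ σ) k Q?
  Q?₁ = Q? ∘ (inside ∷_)
  ∣σ∣≡k : ∣ σ ∣ ≡ k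
  ∣σ∣≡k = suc-injective ∣σ∣+1≡1+k

  count-∋zero : ∀ k → ∣ σ ∣ ≡ k → count (facet? (inside ∷ σ) k Q? ∘ (inside ∷_)) ≡ ∣ removable σ Q?₁ ∣
  count-∋zero zero ∣σ∣≡0 = begin
    count (facet? (inside ∷ σ) 0 Q? ∘ (inside ∷_))  ≡⟨ count-none (facet? (inside ∷ σ) 0 Q? ∘ (inside ∷_)) (λ τ ()) ⟩
    0                                               ≡⟨ n≤0⇒n≡0 (subst (∣ removable σ Q?₁ ∣ ≤_) ∣σ∣≡0 (p⊆q⇒∣p∣≤∣q∣ (removable⊆ Q?₁))) ⟨
    ∣ removable σ Q?₁ ∣                             ∎
  count-∋zero (suc k) ∣σ∣≡1+k = begin
    count (facet? (inside ∷ σ) (suc k) Q? ∘ (inside ∷_))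
      ≡⟨ count-≐ (facet? (inside ∷ σ) (suc k) Q? ∘ (inside ∷_)) (facet? σ k Q?₁)
           ((λ (τ⊆σ , ∣τ∣+1≡1+k , q) → drop-∷-⊆ τ⊆σ , suc-injective ∣τ∣+1≡1+k , q) ,
             λ (τ⊆σ , ∣τ∣≡k , q) → s⊆s τ⊆σ , cong suc ∣τ∣≡k , q) ⟩
    count (facet? σ k Q?₁)
      ≡⟨ count-facets σ k Q?₁ ∣σ∣≡1+k ⟩
    ∣ removable σ Q?₁ ∣ ∎

  ∌zero⇒≡σ : ∀ {τ} → outside ∷ τ ⊆ inside ∷ σ × ∣ τ ∣ ≡ k × Q (outside ∷ τ) → τ ≡ σ
  ∌zero⇒≡σ (τ⊆σ , ∣τ∣≡k , _) = ⊆-card-antisym (drop-∷-⊆ τ⊆σ) (≤-reflexive (trans ∣σ∣≡k (sym ∣τ∣≡k)))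

  count-∌zero : ∀ r →
    count (P? ∘ (outside ∷_)) + ∣ r ∣ ≡ ∣ ⌊ (zero ∈? inside ∷ σ) ×-dec Q? (outside ∷ (σ ─ ⊥)) ⌋ ∷ r ∣
  count-∌zero r rewrite p─⊥≡p σ with Q? (outside ∷ σ)
  ... | yes q = cong (_+ ∣ r ∣) (count-singleton (P? ∘ (outside ∷_)) σ
                  (∌zero⇒≡σ , λ { refl → out⊆ ⊆-refl , ∣σ∣≡k , q }))
  ... | no ¬q = cong (_+ ∣ r ∣) (count-none (P? ∘ (outside ∷_))
                  λ τ P → ¬q (subst (Q ∘ (outside ∷_)) (∌zero⇒≡σ P) (proj₂ (proj₂ P))))

record Enumeration {n} (p : Subset n) (m : ℕ) : Set where
  field
    index      : Fin m → Fin n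
    injective  : Injective _≡_ _≡_ index
    index∈     : ∀ j → index j ∈ p
    surjective : ∀ i → i ∈ p → ∃ λ j → index j ≡ i
open Enumeration

enumerate : ∀ {n} (p : Subset n) → Enumeration p ∣ p ∣
enumerate [] = record
  { index = λ () ; injective = λ { {()} } ; index∈ = λ () ; surjective = λ _ () }
enumerate (inside ∷ p) = record
  { index = idx ; injective = inj ; index∈ = idx∈ ; surjective = surj }
  where
  e = enumerate p
  idx : Fin (suc ∣ p ∣) → Fin _
  idx zero    = zero
  idx (suc j) = suc (index e j)
  inj : Injective _≡_ _≡_ idx
  inj {zero}  {zero}  _  = refl
  inj {suc i} {suc j} eq = cong suc (injective e (Fin.suc-injective eq))
  idx∈ : ∀ j → idx j ∈ inside ∷ p
  idx∈ zero    = here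
  idx∈ (suc j) = there (index∈ e j)
  surj : ∀ i → i ∈ inside ∷ p → ∃ λ j → idx j ≡ i
  surj zero    _         = zero , refl
  surj (suc i) (there i∈p) = let j , eq = surjective e i i∈p in suc j , cong suc eq
enumerate (outside ∷ p) = record
  { index = suc ∘ index e
  ; injective = injective e ∘ Fin.suc-injective
  ; index∈ = there ∘ index∈ e
  ; surjective = λ { (suc i) (there i∈p) → let j , eq = surjective e i i∈p in j , cong suc eq } }
  where
  e = enumerate p

-- Keeps index unchanged (unlike subst), so take-preimage-∪ survives the cast.
Enumeration-cast : ∀ {n m} {p q : Subset n} → p ≡ q → Enumeration p m → Enumeration q m
Enumeration-cast p≡q e = record
  { index = index e
  ; injective = injective e
  ; index∈ = λ j → subst (index e j ∈_) p≡q (index∈ e j)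
  ; surjective = λ i i∈q → surjective e i (subst (i ∈_) (sym p≡q) i∈q)
  }

Enumeration-∪ : ∀ {n a b} {p q : Subset n} → Enumeration p a → Enumeration q b →
  (∀ {x} → x ∈ p → x ∉ q) → Enumeration (p ∪ q) (a + b)
Enumeration-∪ {a = a} {b} {p} {q} e f disjoint = record
  { index = index-⊎ ∘ splitAt a
  ; injective = λ {i} {j} eq → begin
      i                        ≡⟨ Fin.join-splitAt a b i ⟨
      join a b (splitAt a i)   ≡⟨ cong (join a b) (index-⊎-injective (splitAt a i) (splitAt a j) eq) ⟩
      join a b (splitAt a j)   ≡⟨ Fin.join-splitAt a b j ⟩
      j ∎
  ; index∈ = index-⊎∈ ∘ splitAt a
  ; surjective = λ i i∈p∪q → case x∈p∪q⁻ p q i∈p∪q of λ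
      { (inj₁ i∈p) → let j , eq = surjective e i i∈p in j ↑ˡ b , trans (cong index-⊎ (Fin.splitAt-↑ˡ a j b)) eq
      ; (inj₂ i∈q) → let j , eq = surjective f i i∈q in a ↑ʳ j , trans (cong index-⊎ (Fin.splitAt-↑ʳ a b j)) eq }
  }
  where
  open ≡-Reasoning
  index-⊎ : Fin a ⊎ Fin b → Fin _
  index-⊎ = [ index e , index f ]′
  index-⊎∈ : ∀ x → index-⊎ x ∈ p ∪ q
  index-⊎∈ (inj₁ j) = x∈p∪q⁺ (inj₁ (index∈ e j))
  index-⊎∈ (inj₂ j) = x∈p∪q⁺ (inj₂ (index∈ f j))
  index-⊎-injective : ∀ x y → index-⊎ x ≡ index-⊎ y → x ≡ y
  index-⊎-injective (inj₁ i) (inj₁ j) eq = cong inj₁ (injective e eq)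
  index-⊎-injective (inj₂ i) (inj₂ j) eq = cong inj₂ (injective f eq)
  index-⊎-injective (inj₁ i) (inj₂ j) eq = ⊥-elim (disjoint (index∈ e i) (subst (_∈ q) (sym eq) (index∈ f j)))
  index-⊎-injective (inj₂ i) (inj₁ j) eq = ⊥-elim (disjoint (index∈ e j) (subst (_∈ q) eq (index∈ f i)))

take-tabulate : ∀ {A : Set} m {k} (f : Fin (m + k) → A) → take m (tabulate f) ≡ tabulate (f ∘ (_↑ˡ k))
take-tabulate zero    f = refl
take-tabulate (suc m) f = cong (f zero ∷_) (take-tabulate m (f ∘ suc))

take-preimage-∪ : ∀ {n a b} {p q : Subset n} (e : Enumeration p a) (f : Enumeration q b)
  (disjoint : ∀ {x} → x ∈ p → x ∉ q) T →
  take a (preimage (index (Enumeration-∪ e f disjoint)) T) ≡ preimage (index e) T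
take-preimage-∪ {a = a} {b} e f disjoint T = trans (take-tabulate a _)
  (tabulate-cong λ j → cong (lookup T ∘ [ index e , index f ]′) (Fin.splitAt-↑ˡ a j b))

induced-iso : ∀ {n m} (X : Complex n) {U} {Y : Subset m → Set} (e : Enumeration U m) →
  (∀ T → T ⊆ U → face X T ⇔ Y (preimage (index e) T)) → InducedIso X U Y
induced-iso X e faces = index e , injective e , index∈ e , surjective e , faces

∈-preimage⁺ : ∀ {m n} (f : Fin m → Fin n) {T j} → f j ∈ T → j ∈ preimage f T
∈-preimage⁺ f {T} {j} fj∈T = lookup⇒[]= j (preimage f T) (trans (lookup∘tabulate (lookup T ∘ f) j) ([]=⇒lookup fj∈T))

∈-preimage⁻ : ∀ {m n} (f : Fin m → Fin n) {T j} → j ∈ preimage f T → f j ∈ T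
∈-preimage⁻ f {T} {j} j∈f⁻¹T = lookup⇒[]= (f j) T (trans (sym (lookup∘tabulate (lookup T ∘ f) j)) ([]=⇒lookup j∈f⁻¹T))

⊆⇔⊤⊆preimage : ∀ {n m} {p : Subset n} (e : Enumeration p m) {T} → p ⊆ T ⇔ ⊤ ⊆ preimage (index e) T
⊆⇔⊤⊆preimage e = mk⇔
  (λ p⊆T {j} _ → ∈-preimage⁺ (index e) (p⊆T (index∈ e j)))
  (λ ⊤⊆e⁻¹T {i} i∈p → let j , eq = surjective e i i∈p in subst (_∈ _) eq (∈-preimage⁻ (index e) (⊤⊆e⁻¹T ∈⊤)))

¬face⇒missing⊆ : ∀ {n} (X : Complex n) A → ¬ face X A → ∃ λ T → T ⊆ A × Missing X T
¬face⇒missing⊆ X A = go A (On.wellFounded ∣_∣ <-wellFounded A)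
  where
  go : ∀ A → Acc (λ s t → ∣ s ∣ < ∣ t ∣) A → ¬ face X A → ∃ λ T → T ⊆ A × Missing X T
  go A (acc smaller) A∉X with Fin.any? (λ i → (i ∈? A) ×-dec ¬? (face? X (A - i)))
  ... | yes (i , i∈A , A-i∉X) =
    let T , T⊆A-i , T-missing = go (A - i) (smaller (x∈p⇒∣p-x∣<∣p∣ i∈A)) A-i∉X
    in T , ⊆-trans T⊆A-i (p─q⊆p A ⁅ i ⁆) , T-missing
  ... | no ∄i = A , ⊆-refl , A∉X , λ t (t⊆A , x , x∈A , x∉t) →
    down X (λ {y} y∈t → x∈p∧x≢y⇒x∈p-y (t⊆A y∈t) λ { refl → x∉t y∈t })
           (decidable-stable (face? X (A - x)) λ A-x∉X → ∄i (x , x∈A , A-x∉X))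

module NotInLink {n} (X : Complex n) {σ : Subset n} {v : Fin n}
  (σ∈X : face X σ) (v∉σ : v ∉ σ) (v∉lk : ¬ InLink X σ v) where

  U S R : Subset n
  U = ⁅ v ⁆ ∪ σ
  S = ⁅ v ⁆ ∪ M X σ v
  R = σ ─ M X σ v

  M⊆σ : M X σ v ⊆ σ
  M⊆σ = removable⊆ (λ τ → inLink? X τ v)

  S⊆U : S ⊆ U
  S⊆U x∈S = x∈p∪q⁺ (Sum.map₂ M⊆σ (x∈p∪q⁻ ⁅ v ⁆ (M X σ v) x∈S))

  avoids-S⇒face : ∀ {A w} → A ⊆ U → w ∈ S → w ∉ A → face X A
  avoids-S⇒face {A} {w} A⊆U w∈S w∉A with x∈p∪q⁻ ⁅ v ⁆ (M X σ v) w∈S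
  ... | inj₁ w∈⁅v⁆ = down X A⊆σ σ∈X
    where
    A⊆σ : A ⊆ σ
    A⊆σ {y} y∈A with x∈p∪q⁻ ⁅ v ⁆ σ (A⊆U y∈A)
    ... | inj₁ y∈⁅v⁆ = ⊥-elim (w∉A (subst (_∈ A) (trans (x∈⁅y⁆⇒x≡y v y∈⁅v⁆) (sym (x∈⁅y⁆⇒x≡y v w∈⁅v⁆))) y∈A))
    ... | inj₂ y∈σ   = y∈σ
  ... | inj₂ w∈M = down X A⊆σ-w∪v (proj₁ (proj₂ (∈-removable⁻ (λ τ → inLink? X τ v) w∈M)))
    where
    A⊆σ-w∪v : A ⊆ (σ - w) ∪ ⁅ v ⁆
    A⊆σ-w∪v {y} y∈A with x∈p∪q⁻ ⁅ v ⁆ σ (A⊆U y∈A)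
    ... | inj₁ y∈⁅v⁆ = x∈p∪q⁺ (inj₂ y∈⁅v⁆)
    ... | inj₂ y∈σ   = x∈p∪q⁺ (inj₁ (x∈p∧x≢y⇒x∈p-y y∈σ λ { refl → w∉A y∈A }))

  U∉X : ¬ face X U
  U∉X U∈X = v∉lk (subst (face X) (∪-comm ⁅ v ⁆ σ) U∈X , v∉σ)

  missing-face-between : ∃ λ T → S ⊆ T × T ⊆ U × Missing X T
  missing-face-between =
    let T , T⊆U , T-missing = ¬face⇒missing⊆ X U U∉X
    in T , (λ {w} w∈S → decidable-stable (w ∈? T) (proj₁ T-missing ∘ avoids-S⇒face T⊆U w∈S)) , T⊆U , T-missing

  ∣M∣<∣S∣ : ∣ M X σ v ∣ < ∣ S ∣
  ∣M∣<∣S∣ = p⊂q⇒∣p∣<∣q∣ (q⊆p∪q ⁅ v ⁆ (M X σ v) , v , x∈p∪q⁺ (inj₁ (x∈⁅x⁆ v)) , v∉σ ∘ M⊆σ)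

  module _ {d} (missing≤ : ∀ s → Missing X s → ∣ s ∣ ≤ suc d) where

    ∣S∣≤1+d : ∣ S ∣ ≤ suc d
    ∣S∣≤1+d = let T , S⊆T , _ , T-missing = missing-face-between in
      ≤-trans (p⊆q⇒∣p∣≤∣q∣ S⊆T) (missing≤ T T-missing)

    ∣M∣≤d : ∣ M X σ v ∣ ≤ d
    ∣M∣≤d = s≤s⁻¹ (≤-trans ∣M∣<∣S∣ ∣S∣≤1+d)

    module _ (∣M∣≡d : ∣ M X σ v ∣ ≡ d) where

      ∣S∣≡1+d : ∣ S ∣ ≡ suc d
      ∣S∣≡1+d = ≤-antisym ∣S∣≤1+d (subst (_< ∣ S ∣) ∣M∣≡d ∣M∣<∣S∣)

      S-missing : Missing X S
      S-missing = let T , S⊆T , _ , T-missing = missing-face-between in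
        subst (Missing X) (sym (⊆-card-antisym S⊆T (≤-trans (missing≤ T T-missing) (≤-reflexive (sym ∣S∣≡1+d))))) T-missing

      face⇔⊉S : ∀ {A} → A ⊆ U → face X A ⇔ S ⊈ A
      face⇔⊉S {A} A⊆U = mk⇔ face⇒⊉S ⊉S⇒face
        where
        face⇒⊉S : face X A → S ⊈ A
        face⇒⊉S A∈X S⊆A = proj₁ S-missing (down X S⊆A A∈X)
        ⊉S⇒face : S ⊈ A → face X A
        ⊉S⇒face S⊈A = let w , w∈S , w∉A = ⊈⇒∃∉ S⊈A in avoids-S⇒face A⊆U w∈S w∉A

      face⇔∣preimage∣≤d : (e : Enumeration S (suc d)) → ∀ {A} → A ⊆ U → face X A ⇔ ∣ preimage (index e) A ∣ ≤ d
      face⇔∣preimage∣≤d e {A} A⊆U = mk⇔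
        (λ A∈X → from (∣p∣≤n⇔⊤⊈p _) (to (face⇔⊉S A⊆U) A∈X ∘ from (⊆⇔⊤⊆preimage e)))
        (λ ∣e⁻¹A∣≤d → from (face⇔⊉S A⊆U) (to (∣p∣≤n⇔⊤⊈p _) ∣e⁻¹A∣≤d ∘ to (⊆⇔⊤⊆preimage e)))

      enumS : Enumeration S (suc d)
      enumS = subst (Enumeration S) ∣S∣≡1+d (enumerate S)

      S-iso : InducedIso X S (BdSimplex d)
      S-iso = induced-iso X {Y = BdSimplex d} enumS λ A A⊆S → face⇔∣preimage∣≤d enumS (⊆-trans A⊆S S⊆U)

      S∪R≡U : S ∪ R ≡ U
      S∪R≡U = begin
        (⁅ v ⁆ ∪ M X σ v) ∪ (σ ─ M X σ v)   ≡⟨ ∪-assoc ⁅ v ⁆ (M X σ v) (σ ─ M X σ v) ⟩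
        ⁅ v ⁆ ∪ (M X σ v ∪ (σ ─ M X σ v))   ≡⟨ cong (⁅ v ⁆ ∪_) (p⊆q⇒p∪[q─p]≡q M⊆σ) ⟩
        ⁅ v ⁆ ∪ σ                            ∎
        where open ≡-Reasoning

      S∩R=∅ : ∀ {x} → x ∈ S → x ∉ R
      S∩R=∅ x∈S x∈R with x∈p∪q⁻ ⁅ v ⁆ (M X σ v) x∈S
      ... | inj₁ x∈⁅v⁆ = v∉σ (subst (_∈ σ) (x∈⁅y⁆⇒x≡y v x∈⁅v⁆) (p─q⊆p σ (M X σ v) x∈R))
      ... | inj₂ x∈M   = ∈p─q⇒∉q σ (M X σ v) x∈R x∈M

      module _ {k} (∣σ∣≡1+k : ∣ σ ∣ ≡ suc k) where

        ∣R∣≡1+k∸d : ∣ R ∣ ≡ suc k ∸ d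
        ∣R∣≡1+k∸d = begin
          ∣ R ∣                         ≡⟨ m+n∸m≡n d ∣ R ∣ ⟨
          d + ∣ R ∣ ∸ d                 ≡⟨ cong (λ m → m + ∣ R ∣ ∸ d) ∣M∣≡d ⟨
          ∣ M X σ v ∣ + ∣ R ∣ ∸ d       ≡⟨ cong (_∸ d) (p⊆q⇒∣q∣≡∣p∣+∣q─p∣ M⊆σ) ⟨
          ∣ σ ∣ ∸ d                     ≡⟨ cong (_∸ d) ∣σ∣≡1+k ⟩
          suc k ∸ d                     ∎
          where open ≡-Reasoning

        U-iso : InducedIso X U (Join {suc d} {suc k ∸ d} (BdSimplex d) (Full (suc k ∸ d)))
        U-iso = induced-iso X {Y = Join (BdSimplex d) (Full (suc k ∸ d))} enumU λ A A⊆U → mk⇔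
          (λ A∈X → subst (λ W → ∣ W ∣ ≤ d) (sym (take≡ A)) (to (face⇔∣preimage∣≤d enumS A⊆U) A∈X) , tt)
          (λ (∣W∣≤d , _) → from (face⇔∣preimage∣≤d enumS A⊆U) (subst (λ W → ∣ W ∣ ≤ d) (take≡ A) ∣W∣≤d))
          where
          enumR : Enumeration R (suc k ∸ d)
          enumR = subst (Enumeration R) ∣R∣≡1+k∸d (enumerate R)
          enumU : Enumeration U (suc d + (suc k ∸ d))
          enumU = Enumeration-cast S∪R≡U (Enumeration-∪ enumS enumR S∩R=∅)
          take≡ : ∀ A → take (suc d) (preimage (index enumU) A) ≡ preimage (index enumS) A
          take≡ = take-preimage-∪ enumS enumR S∩R=∅

lemma4p5 : ∀ {n} (X : Complex n) (d k : ℕ) (σ : Subset n) (v : Fin n)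
    → HasH X d → σ ∈X[ X ] k → v ∉ σ → ¬ InLink X σ v
    → (cardN X k σ v ≡ ∣ M X σ v ∣ × ∣ M X σ v ∣ ≤ d)
      × (∣ M X σ v ∣ ≡ d
         → InducedIso X (⁅ v ⁆ ∪ M X σ v) (BdSimplex d)
           × InducedIso X (⁅ v ⁆ ∪ σ) (Join {suc d} {suc k ∸ d} (BdSimplex d) (Full (suc k ∸ d))))
-- Only the bound h(X) ≤ d is used, not the existence of a d-dimensional missing face.
lemma4p5 X d k σ v (_ , missing≤) (σ∈X , ∣σ∣≡1+k) v∉σ v∉lk =
    (count-facets σ k (λ τ → inLink? X τ v) ∣σ∣≡1+k , ∣M∣≤d missing≤)
  , λ ∣M∣≡d → S-iso missing≤ ∣M∣≡d , U-iso missing≤ ∣M∣≡d ∣σ∣≡1+k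
  where open NotInLink X σ∈X v∉σ v∉lk
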